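{- Let $S$ be a solid and let $x,y,z\in S$. Then $x\big(e(y)+e(z)\big)=xe(y)+xe(z)$.
   Context: A solid is a set $S$ with binary operations $+$ and $\cdot$ and a relation $\le$ satisfying: (1) $+$ is associative and commutative; for every $x$ there is a unique $e$ with $x+e=x$ and $e+f=e$ whenever $x+f=x$, written $e(x)$ (the magnitude of $x$); for every $x$ there is $s$ with $x+s=e(x)$ and $e(s)=e(x)$, written $-x$; $e(x+y)=e(x)$ or $e(x+y)=e(y)$. (2) $\cdot$ is associative and commutative; for every $x\ne e(x)$ there is a unique $u$ with $xu=x$ and $uv=u$ whenever $xv=x$, written $u(x)$; for every $x\ne e(x)$ there is $d$ with $xd=u(x)$ and $u(d)=u(x)$, written $x^{ -1}$; for $x\ne e(x),y\ne e(y)$: $u(xy)=u(x)$ or $u(xy)=u(y)$. (3) $\le$ is a total order; $x\le y\Rightarrow x+z\le y+z$; $y+e(x)=e(x)\Rightarrow (y\le e(x)$ and $-y\le e(x))$; $(e(x)<x$ and $y\le z)\Rightarrow xy\le xz$; $e(y)\le y\le z\Rightarrow e(x)y\le e(x)z$. (4) For all $x,y$ there is $z$ with $e(x)y=e(z)$; $e(xy)=e(x)y+e(y)x$; for $x\ne e(x)$, $e(u(x))=e(x)x^{ -1}$; $xy+xz=x(y+z)+e(x)y+e(x)z$; $-(xy)=(-x)y$. (5) There is $0$ with $0+x=x$ for all $x$; there is $1$ with $1x=x$ for all $x$; there is $M$ with $e(x)+M=M$ for all $x$; there is $x$ with $e(x)\ne 0$ and $e(x)\ne M$; for every $x$ there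 is $a$ with $x=a+e(x)$ and $e(a)=0$; if $x=e(x)$, $y=e(y)$ and $x<y$ then there is $z\ne e(z)$ with $x<z<y$. -}

module Defs where

open import Level using (Level; _⊔_) renaming (suc to lsuc)
open import Data.Product using (Σ; ∃; _×_; _,_)
open import Data.Sum using (_⊎_)
open import Relation.Binary.PropositionalEquality using (_≡_; _≢_)
open import Relation.Binary.Structures using (IsTotalOrder)

-- A solid (Definition in the paper), with equality taken to be
-- propositional equality on the carrier.  The operations e (magnitude),
-- -_ (opposite), u (unit) and _⁻¹ (inverse) are given as fields together
-- with exactly the characterising properties stated in the axioms.
record Solid (ℓ : Level) : Set (lsuc ℓ) where
  infixl 6 _+_
  infixl 7 _·_
  infix 4 _≤_ _<_
  field
    Carrier : Set ℓ
    _+_     : Carrier → Carrier → Carrier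
    _·_     : Carrier → Carrier → Carrier
    _≤_     : Carrier → Carrier → Set ℓ

    +-assoc : ∀ x y z → (x + y) + z ≡ x + (y + z)
    +-comm  : ∀ x y → x + y ≡ y + x
    e       : Carrier → Carrier
    e-neutral : ∀ x → x + e x ≡ x
    e-min     : ∀ x f → x + f ≡ x → e x + f ≡ e x
    e-unique  : ∀ x e' → x + e' ≡ x → (∀ f → x + f ≡ x → e' + f ≡ e') → e' ≡ e x
    -_      : Carrier → Carrier
    neg-inv : ∀ x → x + (- x) ≡ e x
    neg-e   : ∀ x → e (- x) ≡ e x
    e-+     : ∀ x y → (e (x + y) ≡ e x) ⊎ (e (x + y) ≡ e y)

    ·-assoc : ∀ x y z → (x · y) · z ≡ x · (y · z)
    ·-comm  : ∀ x y → x · y ≡ y · x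
    u       : (x : Carrier) → x ≢ e x → Carrier
    u-neutral : ∀ x (p : x ≢ e x) → x · u x p ≡ x
    u-min     : ∀ x (p : x ≢ e x) v → x · v ≡ x → u x p · v ≡ u x p
    u-unique  : ∀ x (p : x ≢ e x) u' → x · u' ≡ x → (∀ v → x · v ≡ x → u' · v ≡ u') → u' ≡ u x p
    inv     : (x : Carrier) → x ≢ e x → Carrier
    inv-inv : ∀ x (p : x ≢ e x) → x · inv x p ≡ u x p
    inv-u   : ∀ x (p : x ≢ e x) (q : inv x p ≢ e (inv x p)) → u (inv x p) q ≡ u x p
    u-·     : ∀ x y (p : x ≢ e x) (q : y ≢ e y) (r : x · y ≢ e (x · y)) →
              (u (x · y) r ≡ u x p) ⊎ (u (x · y) r ≡ u y q)

    ≤-isTotalOrder : IsTotalOrder _≡_ _≤_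
    ≤-+       : ∀ x y z → x ≤ y → x + z ≤ y + z
    ≤-e       : ∀ x y → y + e x ≡ e x → (y ≤ e x) × (- y ≤ e x)
    ≤-·pos    : ∀ x y z → (e x ≤ x × e x ≢ x) → y ≤ z → x · y ≤ x · z
    ≤-·e      : ∀ x y z → e y ≤ y → y ≤ z → e x · y ≤ e x · z

    e-·-is-e  : ∀ x y → ∃ λ z → e x · y ≡ e z
    e-·       : ∀ x y → e (x · y) ≡ e x · y + e y · x
    e-u       : ∀ x (p : x ≢ e x) → e (u x p) ≡ e x · inv x p
    distr     : ∀ x y z → x · y + x · z ≡ x · (y + z) + e x · y + e x · z
    neg-·     : ∀ x y → - (x · y) ≡ (- x) · y

    0#        : Carrier
    0-id      : ∀ x → 0# + x ≡ x
    1#        : Carrier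
    1-id      : ∀ x → 1# · x ≡ x
    M         : Carrier
    M-abs     : ∀ x → e x + M ≡ M
    nontrivial : ∃ λ x → (e x ≢ 0#) × (e x ≢ M)
    decompose : ∀ x → ∃ λ a → (x ≡ a + e x) × (e a ≡ 0#)
    dense     : ∀ x y → x ≡ e x → y ≡ e y → x ≤ y → x ≢ y →
                ∃ λ z → (z ≢ e z) × ((x ≤ z × x ≢ z) × (z ≤ y × z ≢ y))

  _<_ : Carrier → Carrier → Set ℓ
  x < y = (x ≤ y) × (x ≢ y)

-- Magnitudes (the fixed points of e) are closed under +, and the sum of two of
-- them is the larger one.  So we may assume e z ≤ e y and e y + e z ≡ e y.  The
-- distributivity axiom gives x·e y + x·e z ≡ x·e y + e x·e y + e x·e z; the two
-- correction terms are magnitudes with e x·e z ≤ e x·e y, so they add up to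
-- e x·e y, which is in turn absorbed by x·e y because e (x·e y) contains it as
-- a summand.
module Submission where

open import Defs
open import Level using (Level)
open import Relation.Binary.PropositionalEquality
open import Relation.Binary.Structures using (IsTotalOrder)
open import Data.Product using (_,_; proj₁)
open import Data.Sum using (_⊎_; inj₁; inj₂)

module SolidProperties {ℓ : Level} (S : Solid ℓ) where
  open Solid S
  open IsTotalOrder ≤-isTotalOrder using (antisym; reflexive)
  open ≡-Reasoning

  Magnitude : Carrier → Set ℓ
  Magnitude m = e m ≡ m

  e-magnitude : ∀ a → Magnitude (e a)
  e-magnitude a = sym (e-unique (e a) (e a) (e-min a (e a) (e-neutral a)) (λ _ h → h))

  e·-magnitude : ∀ a b → Magnitude (e a · b)
  e·-magnitude a b with e-·-is-e a b
  ... | w , eq = trans (cong e eq) (trans (e-magnitude w) (sym eq))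

  magnitude⇒+-idem : ∀ {m} → Magnitude m → m + m ≡ m
  magnitude⇒+-idem {m} mag = subst (λ k → k + k ≡ k) mag (e-min m (e m) (e-neutral m))

  +-idem⇒magnitude : ∀ {a} → a + a ≡ a → Magnitude a
  +-idem⇒magnitude {a} idem = begin
    e a      ≡⟨ sym (e-min a a idem) ⟩
    e a + a  ≡⟨ +-comm (e a) a ⟩
    a + e a  ≡⟨ e-neutral a ⟩
    a        ∎

  magnitude-+-magnitude : ∀ {m n} → Magnitude m → Magnitude n → Magnitude (m + n)
  magnitude-+-magnitude {m} {n} mag-m mag-n = +-idem⇒magnitude (begin
    (m + n) + (m + n)  ≡⟨ +-assoc m n (m + n) ⟩
    m + (n + (m + n))  ≡⟨ cong (m +_) (sym (+-assoc n m n)) ⟩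
    m + ((n + m) + n)  ≡⟨ cong (λ k → m + (k + n)) (+-comm n m) ⟩
    m + ((m + n) + n)  ≡⟨ cong (m +_) (+-assoc m n n) ⟩
    m + (m + (n + n))  ≡⟨ cong (λ k → m + (m + k)) (magnitude⇒+-idem mag-n) ⟩
    m + (m + n)        ≡⟨ sym (+-assoc m m n) ⟩
    (m + m) + n        ≡⟨ cong (_+ n) (magnitude⇒+-idem mag-m) ⟩
    m + n              ∎)

  magnitude-+-selective : ∀ {m n} → Magnitude m → Magnitude n →
                          (m + n ≡ m) ⊎ (m + n ≡ n)
  magnitude-+-selective {m} {n} mag-m mag-n with e-+ m n
  ... | inj₁ eq = inj₁ (trans (sym (magnitude-+-magnitude mag-m mag-n)) (trans eq mag-m))
  ... | inj₂ eq = inj₂ (trans (sym (magnitude-+-magnitude mag-m mag-n)) (trans eq mag-n))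

  +-absorbed⇒≤ : ∀ {m n} → Magnitude m → n + m ≡ m → n ≤ m
  +-absorbed⇒≤ {m} {n} mag absorbed =
    subst (n ≤_) mag (proj₁ (≤-e m n (subst (λ k → n + k ≡ k) (sym mag) absorbed)))

  ≤⇒+-absorbed : ∀ {m n} → Magnitude m → Magnitude n → n ≤ m → m + n ≡ m
  ≤⇒+-absorbed {m} {n} mag-m mag-n n≤m with magnitude-+-selective mag-m mag-n
  ... | inj₁ eq = eq
  ... | inj₂ eq = begin
    m + n  ≡⟨ cong (m +_) (sym m≡n) ⟩
    m + m  ≡⟨ magnitude⇒+-idem mag-m ⟩
    m      ∎
    where
    m≡n : m ≡ n
    m≡n = antisym (+-absorbed⇒≤ mag-n eq) n≤m

  absorbed-by-e⇒absorbed : ∀ a n → e a + n ≡ e a → a + n ≡ a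
  absorbed-by-e⇒absorbed a n absorbed = begin
    a + n          ≡⟨ cong (_+ n) (sym (e-neutral a)) ⟩
    (a + e a) + n  ≡⟨ +-assoc a (e a) n ⟩
    a + (e a + n)  ≡⟨ cong (a +_) absorbed ⟩
    a + e a        ≡⟨ e-neutral a ⟩
    a              ∎

  +-e·-absorbed : ∀ x w → x · w + e x · w ≡ x · w
  +-e·-absorbed x w = absorbed-by-e⇒absorbed (x · w) P (begin
    e (x · w) + P  ≡⟨ cong (_+ P) (e-· x w) ⟩
    (P + Q) + P    ≡⟨ +-comm (P + Q) P ⟩
    P + (P + Q)    ≡⟨ sym (+-assoc P P Q) ⟩
    (P + P) + Q    ≡⟨ cong (_+ Q) (magnitude⇒+-idem (e·-magnitude x w)) ⟩
    P + Q          ≡⟨ sym (e-· x w) ⟩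
    e (x · w)      ∎)
    where
    P = e x · w
    Q = e w · x

  ·-distribˡ-+-absorbing : ∀ x {m n} → Magnitude m → Magnitude n → m + n ≡ m →
                           x · (m + n) ≡ x · m + x · n
  ·-distribˡ-+-absorbing x {m} {n} mag-m mag-n m+n≡m = sym (begin
    x · m + x · n                          ≡⟨ distr x m n ⟩
    x · (m + n) + e x · m + e x · n        ≡⟨ cong (λ k → x · k + e x · m + e x · n) m+n≡m ⟩
    x · m + e x · m + e x · n              ≡⟨ +-assoc (x · m) (e x · m) (e x · n) ⟩
    x · m + (e x · m + e x · n)            ≡⟨ cong (x · m +_) corrections ⟩
    x · m + e x · m                        ≡⟨ +-e·-absorbed x m ⟩
    x · m                                  ≡⟨ cong (x ·_) (sym m+n≡m) ⟩
    x · (m + n)                            ∎)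
    where
    n≤m : n ≤ m
    n≤m = +-absorbed⇒≤ mag-m (trans (+-comm n m) m+n≡m)
    corrections : e x · m + e x · n ≡ e x · m
    corrections = ≤⇒+-absorbed (e·-magnitude x m) (e·-magnitude x n)
                    (≤-·e x n m (reflexive mag-n) n≤m)

  ·-distribˡ-+-magnitude : ∀ x {m n} → Magnitude m → Magnitude n →
                           x · (m + n) ≡ x · m + x · n
  ·-distribˡ-+-magnitude x {m} {n} mag-m mag-n with magnitude-+-selective mag-m mag-n
  ... | inj₁ m+n≡m = ·-distribˡ-+-absorbing x mag-m mag-n m+n≡m
  ... | inj₂ m+n≡n = begin
    x · (m + n)    ≡⟨ cong (x ·_) (+-comm m n) ⟩
    x · (n + m)    ≡⟨ ·-distribˡ-+-absorbing x mag-n mag-m (trans (+-comm n m) m+n≡n) ⟩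
    x · n + x · m  ≡⟨ +-comm (x · n) (x · m) ⟩
    x · m + x · n  ∎

proposition2p28 : {ℓ : Level} (S : Solid ℓ) → let open Solid S in
    ∀ x y z → x · (e y + e z) ≡ x · e y + x · e z
proposition2p28 S x y z =
  ·-distribˡ-+-magnitude x (e-magnitude y) (e-magnitude z)
  where open SolidProperties S
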